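{- Let $(W,S)$ be an irreducible finite Coxeter system of rank $r$ with exponents $m_1\leqslant\dots\leqslant m_r$, Coxeter number $h$ and invariant $\gamma$, and let $A,B,\alpha,\beta$ be positive integers with $$\sum_{i=1}^r q^{m_i}=\frac{q(1-q^A)(1-q^B)}{(1-q^\alpha)(1-q^\beta)}.$$ Then $$A+B=h-2+\alpha+\beta,\qquad AB=h^2-\gamma+(h-2)(\alpha+\beta-1)+\alpha\beta,$$ and for every $n\geqslant0$, $$X_n:=\sum_{j=0}^nA^jB^{n-j}=\sum_{j=0}^{\lfloor n/2\rfloor}(-1)^j\binom{n-j}{j}(h-2+\alpha+\beta)^{n-2j}\bigl(h^2-\gamma+(h-2)(\alpha+\beta-1)+\alpha\beta\bigr)^j.$$
   Context: Exponents: for $S=\{s_1,\dots,s_r\}$, the Coxeter element $c=s_1\cdots s_r$ has order $h$ (the Coxeter number) and eigenvalues $e^{2\pi i m_j/h}$ in the reflection representation, $1=m_1\leqslant\dots\leqslant m_r=h-1$. The invariant $\gamma$: for crystallographic types with (reduced, irreducible) root system $\Phi$, $\gamma$ is defined by $\sum_{\varphi\in\Phi}\frac{\langle\lambda|\varphi\rangle\langle\mu|\varphi\rangle}{\langle\varphi|\varphi\rangle^2}=\gamma\langle\lambda|\mu\rangle$ for all $\lambda,\mu\in\operatorname{span}_{\mathbb R}\Phi$, where $\langle\cdot|\cdot\rangle$ is the Killing form, the $W$-invariant symmetric bilinear form with $\langle\lambda|\mu\rangle=\sum_{\varphi\in\Phi}\langle\lambda|\varphi\rangle\langle\mu|\varphi\rangle$.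 For noncrystallographic types, $\gamma=2m^2-5m+6$ for $\mathsf I_2(m)$, $\gamma=124$ for $\mathsf H_3$, $\gamma=1116$ for $\mathsf H_4$. Explicitly, $\gamma=(r+1)^2$ for $\mathsf A_r$, $4r^2+2r-2$ for $\mathsf B_r,\mathsf C_r$, $(2r-2)^2$ for $\mathsf D_r$, $144,324,900$ for $\mathsf E_6,\mathsf E_7,\mathsf E_8$, $162$ for $\mathsf F_4$, $48$ for $\mathsf G_2$. -}

module Defs where

open import Data.Nat as ℕ using (ℕ; zero; suc; ⌊_/2⌋)
open import Data.Nat.Combinatorics using (_C_)
open import Data.Integer as ℤ using (ℤ; +_; _+_; _-_; _*_; _^_; -_)
open import Data.List using (List; []; _∷_; map; upTo; _++_; foldr)

-- Parameters are shifted so that every constructor value is a genuine type: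
--   A k = A_{k+1} (rank ≥ 1), B k = B_{k+2} (= C_{k+2}, rank ≥ 2),
--   D k = D_{k+4} (rank ≥ 4), I k = I_2(k+3) (m ≥ 3).
data CoxeterType : Set where
  A  : ℕ → CoxeterType
  B  : ℕ → CoxeterType
  D  : ℕ → CoxeterType
  E6 E7 E8 F4 G2 H3 H4 : CoxeterType
  I  : ℕ → CoxeterType

rank : CoxeterType → ℕ
rank (A k) = suc k
rank (B k) = 2 ℕ.+ k
rank (D k) = 4 ℕ.+ k
rank E6 = 6
rank E7 = 7
rank E8 = 8
rank F4 = 4
rank G2 = 2
rank H3 = 3
rank H4 = 4
rank (I k) = 2

coxeterNumber : CoxeterType → ℕ
coxeterNumber (A k) = 2 ℕ.+ k                 -- r + 1
coxeterNumber (B k) = 2 ℕ.* (2 ℕ.+ k)         -- 2r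
coxeterNumber (D k) = 2 ℕ.* (4 ℕ.+ k) ℕ.∸ 2   -- 2r - 2
coxeterNumber E6 = 12
coxeterNumber E7 = 18
coxeterNumber E8 = 30
coxeterNumber F4 = 12
coxeterNumber G2 = 6
coxeterNumber H3 = 10
coxeterNumber H4 = 30
coxeterNumber (I k) = 3 ℕ.+ k                 -- m

arith : ℕ → ℕ → ℕ → List ℕ
arith a d zero    = []
arith a d (suc n) = a ∷ arith (a ℕ.+ d) d n

exponents : CoxeterType → List ℕ
exponents (A k) = arith 1 1 (suc k)                     -- 1,2,…,r
exponents (B k) = arith 1 2 (2 ℕ.+ k)                   -- 1,3,…,2r-1
exponents (D k) = arith 1 2 (3 ℕ.+ k) ++ (3 ℕ.+ k ∷ []) -- 1,3,…,2r-3 and r-1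
exponents E6 = 1 ∷ 4 ∷ 5 ∷ 7 ∷ 8 ∷ 11 ∷ []
exponents E7 = 1 ∷ 5 ∷ 7 ∷ 9 ∷ 11 ∷ 13 ∷ 17 ∷ []
exponents E8 = 1 ∷ 7 ∷ 11 ∷ 13 ∷ 17 ∷ 19 ∷ 23 ∷ 29 ∷ []
exponents F4 = 1 ∷ 5 ∷ 7 ∷ 11 ∷ []
exponents G2 = 1 ∷ 5 ∷ []
exponents H3 = 1 ∷ 5 ∷ 9 ∷ []
exponents H4 = 1 ∷ 11 ∷ 19 ∷ 29 ∷ []
exponents (I k) = 1 ∷ 2 ℕ.+ k ∷ []                      -- 1, m-1

gammaInv : CoxeterType → ℕ
gammaInv (A k) = (2 ℕ.+ k) ℕ.* (2 ℕ.+ k)                          -- (r+1)^2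
gammaInv (B k) = 4 ℕ.* r ℕ.* r ℕ.+ 2 ℕ.* r ℕ.∸ 2 where r = 2 ℕ.+ k
gammaInv (D k) = (2 ℕ.* r ℕ.∸ 2) ℕ.* (2 ℕ.* r ℕ.∸ 2) where r = 4 ℕ.+ k
gammaInv E6 = 144
gammaInv E7 = 324
gammaInv E8 = 900
gammaInv F4 = 162
gammaInv G2 = 48
gammaInv H3 = 124
gammaInv H4 = 1116
gammaInv (I k) = 2 ℕ.* m ℕ.* m ℕ.+ 6 ℕ.∸ 5 ℕ.* m where m = 3 ℕ.+ k

sumℤ : List ℤ → ℤ
sumℤ = foldr _+_ (+ 0)

expPoly : CoxeterType → ℤ → ℤ
expPoly T q = sumℤ (map (λ m → q ^ m) (exponents T))

X : ℤ → ℤ → ℕ → ℤ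
X a b n = sumℤ (map (λ j → a ^ j * b ^ (n ℕ.∸ j)) (upTo (suc n)))

chebSum : ℤ → ℤ → ℕ → ℤ
chebSum s p n = sumℤ (map (λ j → (- + 1) ^ j * + ((n ℕ.∸ j) C j)
                                  * s ^ (n ℕ.∸ 2 ℕ.* j) * p ^ j)
                          (upTo (suc ⌊ n /2⌋)))

{-# OPTIONS --safe #-}
-- Write q = 1 + t and P(q) = Σ q^(mᵢ).  As 1 − q^a = (1 − q)[a]_q with [a]_q = 1 + q + ⋯ + q^(a−1),
-- the hypothesis divided by (1 − q)² says P(q)[α]_q[β]_q = q[A]_q[B]_q for t ≠ 0, so the two sides
-- have the same expansion up to t².  The expansion of P starts with r, (Σ mᵢ) t = (rh/2) t and
-- (Σ mᵢ(mᵢ − 1)/2) t² = (r(h² − 4h + γ)/12) t², which is checked on the classification; q is the P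
-- of type A₁, with (r, h, γ) = (1, 2, 4).  Multiplying out, 432 P(q)[α]_q[β]_q expands as
-- 36rαβ (12 + 6σ t + (2σ² − 3σ − 1 − π) t²), where σ and π are the claimed values of A + B and AB,
-- while the right-hand side gives the same with rαβ, σ, π replaced by AB, A + B, AB.  Cancelling
-- rαβ = AB yields both identities.  Finally X_n and the alternating binomial sum satisfy the same
-- recurrence x_{n+2} = (A + B) x_{n+1} − AB x_n with the same initial values.
module Submission where

open import Defs
open import Data.Nat using (ℕ; _≤_)
open import Data.Integer using (ℤ; +_; _+_; _-_; _*_; _^_)
open import Data.Product using (_×_)
open import Relation.Binary.PropositionalEquality using (_≡_)

open import Function using (id; _∘_)
open import Data.Nat as ℕ using (zero; suc; _<_; _≤′_; s≤s; z≤n; ⌊_/2⌋)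
import Data.Nat.Properties as ℕₚ
open import Data.Nat.Combinatorics using (_C_; nCk+nC[k+1]≡[n+1]C[k+1]; k>n⇒nCk≡0)
open import Data.Nat.Divisibility using (∣⇒≤)
import Data.Nat.Tactic.RingSolver as ℕ-Solver
open import Data.Integer using (0ℤ; +0; +[1+_]; -[1+_]; -_; ∣_∣; ≢-nonZero)
open import Data.Integer.Divisibility using (_∣_; divides)
import Data.Integer.Properties as ℤₚ
open import Data.Integer.Tactic.RingSolver using (solve; solve-∀)
open import Data.List using (List; []; _∷_; _++_; map; length; applyUpTo)
open import Data.List.Properties using (map-applyUpTo; map-++; length-++)
open import Data.Product using (_,_; proj₁; proj₂; ∃-syntax; map₂)
open import Data.Sum using (inj₁; inj₂)
open import Data.Empty using (⊥-elim)
open import Relation.Nullary using (yes; no)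
open import Relation.Binary.PropositionalEquality
  using (refl; sym; trans; cong; cong₂; subst; subst₂; _≢_; _≗_; module ≡-Reasoning)

open ≡-Reasoning

-- Second-order expansions at q = 1

record HasJet (f : ℤ → ℤ) (c₀ c₁ c₂ : ℤ) : Set where
  constructor mkJet
  field expand : ∀ t → ∃[ R ] f (+ 1 + t) ≡ c₀ + t * (c₁ + t * (c₂ + t * R))
open HasJet

jet-const : ∀ c → HasJet (λ _ → c) c (+ 0) (+ 0)
jet-const c = mkJet λ t → + 0 , solve (c ∷ t ∷ [])

jet-id : HasJet (λ q → q) (+ 1) (+ 1) (+ 0)
jet-id = mkJet λ t → + 0 , solve (t ∷ [])

jet-cong : ∀ {f a₀ a₁ a₂ b₀ b₁ b₂} → HasJet f a₀ a₁ a₂ →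
           a₀ ≡ b₀ → a₁ ≡ b₁ → a₂ ≡ b₂ → HasJet f b₀ b₁ b₂
jet-cong jf refl refl refl = jf

jet-resp : ∀ {f g c₀ c₁ c₂} → f ≗ g → HasJet f c₀ c₁ c₂ → HasJet g c₀ c₁ c₂
jet-resp f≗g jf = mkJet λ t → map₂ (trans (sym (f≗g (+ 1 + t)))) (expand jf t)

module _ {f g : ℤ → ℤ} {a₀ a₁ a₂ b₀ b₁ b₂ : ℤ}
         (jf : HasJet f a₀ a₁ a₂) (jg : HasJet g b₀ b₁ b₂) where

  jet-+ : HasJet (λ q → f q + g q) (a₀ + b₀) (a₁ + b₁) (a₂ + b₂)
  jet-+ = mkJet expansion
    where
    expansion : ∀ t → ∃[ R ] f (+ 1 + t) + g (+ 1 + t)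
                               ≡ (a₀ + b₀) + t * ((a₁ + b₁) + t * ((a₂ + b₂) + t * R))
    expansion t with expand jf t | expand jg t
    ... | R , f≡ | S , g≡ = R + S , (begin
      f (+ 1 + t) + g (+ 1 + t)
        ≡⟨ cong₂ _+_ f≡ g≡ ⟩
      (a₀ + t * (a₁ + t * (a₂ + t * R))) + (b₀ + t * (b₁ + t * (b₂ + t * S)))
        ≡⟨ solve (a₀ ∷ a₁ ∷ a₂ ∷ b₀ ∷ b₁ ∷ b₂ ∷ t ∷ R ∷ S ∷ []) ⟩
      (a₀ + b₀) + t * ((a₁ + b₁) + t * ((a₂ + b₂) + t * (R + S))) ∎)

  jet-- : HasJet (λ q → f q - g q) (a₀ - b₀) (a₁ - b₁) (a₂ - b₂)
  jet-- = mkJet expansion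
    where
    expansion : ∀ t → ∃[ R ] f (+ 1 + t) - g (+ 1 + t)
                               ≡ (a₀ - b₀) + t * ((a₁ - b₁) + t * ((a₂ - b₂) + t * R))
    expansion t with expand jf t | expand jg t
    ... | R , f≡ | S , g≡ = R - S , (begin
      f (+ 1 + t) - g (+ 1 + t)
        ≡⟨ cong₂ _-_ f≡ g≡ ⟩
      (a₀ + t * (a₁ + t * (a₂ + t * R))) - (b₀ + t * (b₁ + t * (b₂ + t * S)))
        ≡⟨ solve (a₀ ∷ a₁ ∷ a₂ ∷ b₀ ∷ b₁ ∷ b₂ ∷ t ∷ R ∷ S ∷ []) ⟩
      (a₀ - b₀) + t * ((a₁ - b₁) + t * ((a₂ - b₂) + t * (R - S))) ∎)

  jet-* : HasJet (λ q → f q * g q)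
            (a₀ * b₀) (a₀ * b₁ + a₁ * b₀) (a₀ * b₂ + a₁ * b₁ + a₂ * b₀)
  jet-* = mkJet expansion
    where
    expansion : ∀ t → ∃[ R ] f (+ 1 + t) * g (+ 1 + t)
      ≡ a₀ * b₀ + t * ((a₀ * b₁ + a₁ * b₀) + t * ((a₀ * b₂ + a₁ * b₁ + a₂ * b₀) + t * R))
    expansion t with expand jf t | expand jg t
    ... | R , f≡ | S , g≡ =
      a₁ * b₂ + a₂ * b₁ + t * a₂ * b₂
        + R * (b₀ + t * (b₁ + t * (b₂ + t * S))) + (a₀ + t * (a₁ + t * a₂)) * S ,
      (begin
      f (+ 1 + t) * g (+ 1 + t)
        ≡⟨ cong₂ _*_ f≡ g≡ ⟩
      (a₀ + t * (a₁ + t * (a₂ + t * R))) * (b₀ + t * (b₁ + t * (b₂ + t * S)))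
        ≡⟨ solve (a₀ ∷ a₁ ∷ a₂ ∷ b₀ ∷ b₁ ∷ b₂ ∷ t ∷ R ∷ S ∷ []) ⟩
      a₀ * b₀ + t * ((a₀ * b₁ + a₁ * b₀) + t * ((a₀ * b₂ + a₁ * b₁ + a₂ * b₀)
        + t * (a₁ * b₂ + a₂ * b₁ + t * a₂ * b₂
               + R * (b₀ + t * (b₁ + t * (b₂ + t * S))) + (a₀ + t * (a₁ + t * a₂)) * S))) ∎)

divisible-by-all⇒0 : ∀ {e} → (∀ d → d ≢ 0ℤ → d ∣ e) → e ≡ 0ℤ
divisible-by-all⇒0 {+0}       _   = refl
divisible-by-all⇒0 {+[1+ n ]} d∣e = ⊥-elim (ℕₚ.1+n≰n (∣⇒≤ (d∣e +[1+ suc n ] λ ())))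
divisible-by-all⇒0 { -[1+ n ]} d∣e = ⊥-elim (ℕₚ.1+n≰n (∣⇒≤ (d∣e +[1+ suc n ] λ ())))

c+d*x≡0⇒d∣c : ∀ {c d x} → c + d * x ≡ 0ℤ → d ∣ c
c+d*x≡0⇒d∣c {c} {d} {x} eq =
  divides ∣ - x ∣ (trans (cong ∣_∣ c≡d*-x) (trans (ℤₚ.abs-* d (- x)) (ℕₚ.*-comm ∣ d ∣ ∣ - x ∣)))
  where
  c≡d*-x : c ≡ d * - x
  c≡d*-x = begin
    c                     ≡⟨ solve (c ∷ d ∷ x ∷ []) ⟩
    (c + d * x) + d * - x ≡⟨ cong (_+ d * - x) eq ⟩
    0ℤ + d * - x          ≡⟨ ℤₚ.+-identityˡ (d * - x) ⟩
    d * - x               ∎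

constant-term-vanishes : ∀ {c} {F : ℤ → ℤ → ℤ} →
  (∀ t → t ≢ 0ℤ → ∃[ Y ] c + t * F t Y ≡ 0ℤ) →
  c ≡ 0ℤ × (∀ t → t ≢ 0ℤ → ∃[ Y ] F t Y ≡ 0ℤ)
constant-term-vanishes {c} vanish = c≡0 , λ t t≢0 → map₂ (cancel t t≢0) (vanish t t≢0)
  where
  c≡0 : c ≡ 0ℤ
  c≡0 = divisible-by-all⇒0 λ d d≢0 → c+d*x≡0⇒d∣c {c} {d} (proj₂ (vanish d d≢0))
  t*z≡0 : ∀ t z → c + t * z ≡ 0ℤ → t * z ≡ 0ℤ
  t*z≡0 t z eq = begin
    t * z      ≡⟨ ℤₚ.+-identityˡ (t * z) ⟨
    0ℤ + t * z ≡⟨ cong (_+ t * z) c≡0 ⟨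
    c + t * z  ≡⟨ eq ⟩
    0ℤ         ∎
  cancel : ∀ t → t ≢ 0ℤ → ∀ {z} → c + t * z ≡ 0ℤ → z ≡ 0ℤ
  cancel t t≢0 {z} eq with ℤₚ.i*j≡0⇒i≡0∨j≡0 t (t*z≡0 t z eq)
  ... | inj₁ t≡0 = ⊥-elim (t≢0 t≡0)
  ... | inj₂ z≡0 = z≡0

jet-of-vanishing : ∀ {h c₀ c₁ c₂} → HasJet h c₀ c₁ c₂ →
  (∀ t → t ≢ 0ℤ → h (+ 1 + t) ≡ 0ℤ) → c₀ ≡ 0ℤ × c₁ ≡ 0ℤ × c₂ ≡ 0ℤ
jet-of-vanishing {h} {c₀} {c₁} {c₂} jh h≡0 =
  let c₀≡0 , vanish₁ = constant-term-vanishes expansion-vanishes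
      c₁≡0 , vanish₂ = constant-term-vanishes vanish₁
      c₂≡0 , _       = constant-term-vanishes vanish₂
  in c₀≡0 , c₁≡0 , c₂≡0
  where
  expansion-vanishes : ∀ t → t ≢ 0ℤ → ∃[ R ] c₀ + t * (c₁ + t * (c₂ + t * R)) ≡ 0ℤ
  expansion-vanishes t t≢0 = map₂ (λ h≡ → trans (sym h≡) (h≡0 t t≢0)) (expand jh t)

jet-unique : ∀ {f g a₀ a₁ a₂ b₀ b₁ b₂} → HasJet f a₀ a₁ a₂ → HasJet g b₀ b₁ b₂ →
  (∀ t → t ≢ 0ℤ → f (+ 1 + t) ≡ g (+ 1 + t)) → a₀ ≡ b₀ × a₁ ≡ b₁ × a₂ ≡ b₂
jet-unique jf jg f≡g =
  let d₀ , d₁ , d₂ = jet-of-vanishing (jet-- jf jg) (λ t t≢0 → ℤₚ.i≡j⇒i-j≡0 (f≡g t t≢0))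
  in ℤₚ.i-j≡0⇒i≡j _ _ d₀ , ℤₚ.i-j≡0⇒i≡j _ _ d₁ , ℤₚ.i-j≡0⇒i≡j _ _ d₂

-- Quantum integers

[_]_ : ℕ → ℤ → ℤ
[ zero  ] q = + 0
[ suc a ] q = + 1 + q * [ a ] q

1-q^a≡[1-q][a]q : ∀ a q → + 1 - q ^ a ≡ (+ 1 - q) * [ a ] q
1-q^a≡[1-q][a]q zero    q = solve (q ∷ [])
1-q^a≡[1-q][a]q (suc a) q = step (q ^ a) ([ a ] q) (1-q^a≡[1-q][a]q a q)
  where
  step : ∀ x y → + 1 - x ≡ (+ 1 - q) * y → + 1 - q * x ≡ (+ 1 - q) * (+ 1 + q * y)
  step x y eq = begin
    + 1 - q * x                   ≡⟨ solve (q ∷ x ∷ []) ⟩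
    (+ 1 - q) + q * (+ 1 - x)     ≡⟨ cong (λ z → (+ 1 - q) + q * z) eq ⟩
    (+ 1 - q) + q * ((+ 1 - q) * y) ≡⟨ solve (q ∷ y ∷ []) ⟩
    (+ 1 - q) * (+ 1 + q * y)     ∎

[a]-jet : ∀ a → HasJet (λ q → + 6 * [ a ] q)
                  (+ 6 * + a) (+ 3 * + a * (+ a - + 1)) (+ a * (+ a - + 1) * (+ a - + 2))
[a]-jet zero    = jet-const (+ 0)
[a]-jet (suc a) = jet-resp (λ q → distribute q ([ a ] q)) (step (+ a) ([a]-jet a))
  where
  distribute : ∀ q y → + 6 + q * (+ 6 * y) ≡ + 6 * (+ 1 + q * y)
  distribute = solve-∀
  step : ∀ {f} x → HasJet f (+ 6 * x) (+ 3 * x * (x - + 1)) (x * (x - + 1) * (x - + 2)) →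
    HasJet (λ q → + 6 + q * f q) (+ 6 * (+ 1 + x)) (+ 3 * (+ 1 + x) * ((+ 1 + x) - + 1))
           ((+ 1 + x) * ((+ 1 + x) - + 1) * ((+ 1 + x) - + 2))
  step x jf = jet-cong (jet-+ (jet-const (+ 6)) (jet-* jet-id jf))
                (solve (x ∷ [])) (solve (x ∷ [])) (solve (x ∷ []))

q^m-jet : ∀ m → HasJet (λ q → + 12 * q ^ m) (+ 12) (+ 12 * + m) (+ 6 * + m * (+ m - + 1))
q^m-jet zero    = jet-const (+ 12)
q^m-jet (suc m) = jet-resp (λ q → commute q (q ^ m)) (step (+ m) (q^m-jet m))
  where
  commute : ∀ q y → q * (+ 12 * y) ≡ + 12 * (q * y)
  commute = solve-∀
  step : ∀ {f} x → HasJet f (+ 12) (+ 12 * x) (+ 6 * x * (x - + 1)) →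
    HasJet (λ q → q * f q) (+ 12) (+ 12 * (+ 1 + x)) (+ 6 * (+ 1 + x) * ((+ 1 + x) - + 1))
  step x jf = jet-cong (jet-* jet-id jf) refl (solve (x ∷ [])) (solve (x ∷ []))

Σm : List ℕ → ℤ
Σm ms = sumℤ (map +_ ms)

Σm[m-1] : List ℕ → ℤ
Σm[m-1] ms = sumℤ (map (λ m → + m * (+ m - + 1)) ms)

power-sum-jet : ∀ ms → HasJet (λ q → + 12 * sumℤ (map (q ^_) ms))
                         (+ 12 * + length ms) (+ 6 * (+ 2 * Σm ms)) (+ 6 * Σm[m-1] ms)
power-sum-jet []       = jet-const (+ 0)
power-sum-jet (m ∷ ms) =
  jet-resp (λ q → sym (ℤₚ.*-distribˡ-+ (+ 12) (q ^ m) _))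
    (step (+ m) (+ length ms) (Σm ms) (Σm[m-1] ms) (q^m-jet m) (power-sum-jet ms))
  where
  step : ∀ {f g} x n s₁ s₂ →
    HasJet f (+ 12) (+ 12 * x) (+ 6 * x * (x - + 1)) →
    HasJet g (+ 12 * n) (+ 6 * (+ 2 * s₁)) (+ 6 * s₂) →
    HasJet (λ q → f q + g q) (+ 12 * (+ 1 + n)) (+ 6 * (+ 2 * (x + s₁)))
                             (+ 6 * (x * (x - + 1) + s₂))
  step x n s₁ s₂ jf jg = jet-cong (jet-+ jf jg)
    (solve (n ∷ [])) (solve (x ∷ s₁ ∷ [])) (solve (x ∷ s₂ ∷ []))

-- Comparing coefficients

product-jet : ∀ {P F G} r h γ a b {s p} →
  s ≡ h - + 2 + a + b → p ≡ h * h - γ + (h - + 2) * (a + b - + 1) + a * b →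
  HasJet P (+ 12 * r) (+ 6 * (r * h)) (r * (h * h - + 4 * h + γ)) →
  HasJet F (+ 6 * a) (+ 3 * a * (a - + 1)) (a * (a - + 1) * (a - + 2)) →
  HasJet G (+ 6 * b) (+ 3 * b * (b - + 1)) (b * (b - + 1) * (b - + 2)) →
  HasJet (λ q → P q * (F q * G q))
    (+ 36 * r * (a * b) * + 12)
    (+ 36 * r * (a * b) * (+ 6 * s))
    (+ 36 * r * (a * b) * (+ 2 * s * s - + 3 * s - + 1 - p))
product-jet r h γ a b refl refl jP jF jG = jet-cong (jet-* jP (jet-* jF jG))
  (solve (r ∷ a ∷ b ∷ []))
  (solve (r ∷ h ∷ a ∷ b ∷ []))
  (solve (r ∷ h ∷ γ ∷ a ∷ b ∷ []))

scaled-coefficients-determine : ∀ {k k′ s s′ p p′ : ℤ} → k ≢ 0ℤ →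
  k * + 12 ≡ k′ * + 12 → k * (+ 6 * s) ≡ k′ * (+ 6 * s′) →
  k * (+ 2 * s * s - + 3 * s - + 1 - p) ≡ k′ * (+ 2 * s′ * s′ - + 3 * s′ - + 1 - p′) →
  s ≡ s′ × p ≡ p′
scaled-coefficients-determine {k} {k′} {s} {s′} {p} {p′} k≢0 e₀ e₁ e₂
  with ℤₚ.*-cancelʳ-≡ k k′ (+ 12) e₀
... | refl = s≡s′ , p≡p′
  where
  instance _ = ≢-nonZero k≢0
  s≡s′ : s ≡ s′
  s≡s′ = ℤₚ.*-cancelˡ-≡ (+ 6) s s′ (ℤₚ.*-cancelˡ-≡ k _ _ e₁)
  p≡p′ : p ≡ p′
  p≡p′ with s≡s′
  ... | refl = begin
    p                                       ≡⟨ solve (s ∷ p ∷ []) ⟩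
    (+ 2 * s * s - + 3 * s - + 1) - (+ 2 * s * s - + 3 * s - + 1 - p)
      ≡⟨ cong (λ z → (+ 2 * s * s - + 3 * s - + 1) - z) (ℤₚ.*-cancelˡ-≡ k _ _ e₂) ⟩
    (+ 2 * s * s - + 3 * s - + 1) - (+ 2 * s * s - + 3 * s - + 1 - p′)
                                            ≡⟨ solve (s ∷ p′ ∷ []) ⟩
    p′                                      ∎

*-≢0 : ∀ i j → i ≢ 0ℤ → j ≢ 0ℤ → i * j ≢ 0ℤ
*-≢0 i j i≢0 j≢0 ij≡0 with ℤₚ.i*j≡0⇒i≡0∨j≡0 i ij≡0
... | inj₁ i≡0 = i≢0 i≡0
... | inj₂ j≡0 = j≢0 j≡0

divide-by-[1-q]² : ∀ (P : ℤ → ℤ) α β a b →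
  (∀ q → P q * ((+ 1 - q ^ α) * (+ 1 - q ^ β)) ≡ q * (+ 1 - q ^ a) * (+ 1 - q ^ b)) →
  ∀ q → q ≢ + 1 → P q * ([ α ] q * [ β ] q) ≡ q * ([ a ] q * [ b ] q)
divide-by-[1-q]² P α β a b H q q≢1 =
  ℤₚ.*-cancelˡ-≡ (u * u) _ _ {{≢-nonZero (*-≢0 u u u≢0 u≢0)}} (begin
  u * u * (P q * ([ α ] q * [ β ] q))   ≡⟨ regroupˡ u (P q) ([ α ] q) ([ β ] q) ⟩
  P q * ((u * [ α ] q) * (u * [ β ] q))
    ≡⟨ cong₂ (λ x y → P q * (x * y)) (1-q^a≡[1-q][a]q α q) (1-q^a≡[1-q][a]q β q) ⟨
  P q * ((+ 1 - q ^ α) * (+ 1 - q ^ β)) ≡⟨ H q ⟩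
  q * (+ 1 - q ^ a) * (+ 1 - q ^ b)
    ≡⟨ cong₂ (λ x y → q * x * y) (1-q^a≡[1-q][a]q a q) (1-q^a≡[1-q][a]q b q) ⟩
  q * (u * [ a ] q) * (u * [ b ] q)     ≡⟨ regroupʳ u q ([ a ] q) ([ b ] q) ⟩
  u * u * (q * ([ a ] q * [ b ] q))     ∎)
  where
  u = + 1 - q
  u≢0 : u ≢ 0ℤ
  u≢0 u≡0 = q≢1 (sym (ℤₚ.i-j≡0⇒i≡j (+ 1) q u≡0))
  regroupˡ : ∀ u x y z → u * u * (x * (y * z)) ≡ x * ((u * y) * (u * z))
  regroupˡ = solve-∀
  regroupʳ : ∀ u x y z → x * (u * y) * (u * z) ≡ u * u * (x * (y * z))
  regroupʳ = solve-∀

sum-and-product : ∀ (P : ℤ → ℤ) {r h γ} (α β a b : ℕ) → r ≢ 0ℤ → 1 ≤ α → 1 ≤ β →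
  HasJet (λ q → + 12 * P q) (+ 12 * r) (+ 6 * (r * h)) (r * (h * h - + 4 * h + γ)) →
  (∀ q → P q * ((+ 1 - q ^ α) * (+ 1 - q ^ β)) ≡ q * (+ 1 - q ^ a) * (+ 1 - q ^ b)) →
  (+ a + + b ≡ h - + 2 + + α + + β)
  × (+ a * + b ≡ h * h - γ + (h - + 2) * (+ α + + β - + 1) + + α * + β)
sum-and-product P {r} {h} {γ} α β a b r≢0 (s≤s z≤n) (s≤s z≤n) jP H =
  let c₀ , c₁ , c₂ = jet-unique lhs-jet rhs-jet agree
      s≡ , p≡ = scaled-coefficients-determine {k′ = + 36 * + 1 * (+ a * + b)} k≢0 c₀ c₁ c₂
  in sym s≡ , sym p≡
  where
  k≢0 : + 36 * r * (+ α * + β) ≢ 0ℤ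
  k≢0 = *-≢0 (+ 36 * r) (+ α * + β) (*-≢0 (+ 36) r (λ ()) r≢0) (λ ())
  lhs-jet = product-jet r h γ (+ α) (+ β) refl refl jP ([a]-jet α) ([a]-jet β)
  rhs-jet = product-jet (+ 1) (+ 2) (+ 4) (+ a) (+ b) refl (sym (ℤₚ.+-identityˡ (+ a * + b)))
              (jet-* (jet-const (+ 12)) jet-id) ([a]-jet a) ([a]-jet b)
  scale : ∀ x y z → + 12 * x * (+ 6 * y * (+ 6 * z)) ≡ + 432 * (x * (y * z))
  scale = solve-∀
  agree : ∀ t → t ≢ 0ℤ → + 12 * P (+ 1 + t) * (+ 6 * [ α ] (+ 1 + t) * (+ 6 * [ β ] (+ 1 + t)))
                       ≡ + 12 * (+ 1 + t) * (+ 6 * [ a ] (+ 1 + t) * (+ 6 * [ b ] (+ 1 + t)))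
  agree t t≢0 = begin
    + 12 * P q * (+ 6 * [ α ] q * (+ 6 * [ β ] q)) ≡⟨ scale (P q) ([ α ] q) ([ β ] q) ⟩
    + 432 * (P q * ([ α ] q * [ β ] q))           ≡⟨ cong (+ 432 *_) (divide-by-[1-q]² P α β a b H q q≢1) ⟩
    + 432 * (q * ([ a ] q * [ b ] q))             ≡⟨ scale q ([ a ] q) ([ b ] q) ⟨
    + 12 * q * (+ 6 * [ a ] q * (+ 6 * [ b ] q))   ∎
    where
    q = + 1 + t
    q≢1 : q ≢ + 1
    q≢1 q≡1 = t≢0 (begin
      t           ≡⟨ solve (t ∷ []) ⟩
      + 1 + t - + 1 ≡⟨ cong (_- + 1) q≡1 ⟩
      + 1 - + 1   ≡⟨⟩
      0ℤ          ∎)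

-- Power sums of the exponents

record ExponentSums (ms : List ℕ) (r h γ : ℤ) : Set where
  field
    count       : + length ms ≡ r
    sum         : + 2 * Σm ms ≡ r * h
    sum-falling : + 6 * Σm[m-1] ms ≡ r * (h * h - + 4 * h + γ)

exponent-polynomial-jet : ∀ {ms r h γ} → ExponentSums ms r h γ →
  HasJet (λ q → + 12 * sumℤ (map (q ^_) ms)) (+ 12 * r) (+ 6 * (r * h)) (r * (h * h - + 4 * h + γ))
exponent-polynomial-jet {ms} sums =
  jet-cong (power-sum-jet ms) (cong (+ 12 *_) count) (cong (+ 6 *_) sum) sum-falling
  where open ExponentSums sums

sumℤ-++ : ∀ xs ys → sumℤ (xs ++ ys) ≡ sumℤ xs + sumℤ ys
sumℤ-++ []       ys = sym (ℤₚ.+-identityˡ (sumℤ ys))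
sumℤ-++ (x ∷ xs) ys = trans (cong (_+_ x) (sumℤ-++ xs ys)) (sym (ℤₚ.+-assoc x (sumℤ xs) (sumℤ ys)))

length-arith : ∀ a d n → length (arith a d n) ≡ n
length-arith a d zero    = refl
length-arith a d (suc n) = cong suc (length-arith (a ℕ.+ d) d n)

Σm-arith : ∀ a d n → + 2 * Σm (arith a d n) ≡ + n * (+ 2 * + a + + d * (+ n - + 1))
Σm-arith a d zero    = refl
Σm-arith a d (suc n) = step (+ a) (+ d) (+ n) _ (Σm-arith (a ℕ.+ d) d n)
  where
  step : ∀ a d n s → + 2 * s ≡ n * (+ 2 * (a + d) + d * (n - + 1)) →
         + 2 * (a + s) ≡ (+ 1 + n) * (+ 2 * a + d * ((+ 1 + n) - + 1))
  step a d n s eq = begin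
    + 2 * (a + s)                                 ≡⟨ solve (a ∷ s ∷ []) ⟩
    + 2 * a + + 2 * s                             ≡⟨ cong (_+_ (+ 2 * a)) eq ⟩
    + 2 * a + n * (+ 2 * (a + d) + d * (n - + 1)) ≡⟨ solve (a ∷ d ∷ n ∷ []) ⟩
    (+ 1 + n) * (+ 2 * a + d * ((+ 1 + n) - + 1)) ∎

Σm[m-1]-arith : ∀ a d n → + 6 * Σm[m-1] (arith a d n)
  ≡ + n * (+ 6 * + a * (+ a - + 1) + + 3 * + d * (+ 2 * + a - + 1) * (+ n - + 1)
           + + d * + d * (+ n - + 1) * (+ 2 * + n - + 1))
Σm[m-1]-arith a d zero    = refl
Σm[m-1]-arith a d (suc n) = step (+ a) (+ d) (+ n) _ (Σm[m-1]-arith (a ℕ.+ d) d n)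
  where
  step : ∀ a d n s →
    + 6 * s ≡ n * (+ 6 * (a + d) * (a + d - + 1) + + 3 * d * (+ 2 * (a + d) - + 1) * (n - + 1)
                   + d * d * (n - + 1) * (+ 2 * n - + 1)) →
    + 6 * (a * (a - + 1) + s)
      ≡ (+ 1 + n) * (+ 6 * a * (a - + 1) + + 3 * d * (+ 2 * a - + 1) * ((+ 1 + n) - + 1)
                     + d * d * ((+ 1 + n) - + 1) * (+ 2 * (+ 1 + n) - + 1))
  step a d n s eq = begin
    + 6 * (a * (a - + 1) + s)
      ≡⟨ solve (a ∷ s ∷ []) ⟩
    + 6 * a * (a - + 1) + + 6 * s
      ≡⟨ cong (_+_ (+ 6 * a * (a - + 1))) eq ⟩
    + 6 * a * (a - + 1) + n * (+ 6 * (a + d) * (a + d - + 1) + + 3 * d * (+ 2 * (a + d) - + 1) * (n - + 1)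
                               + d * d * (n - + 1) * (+ 2 * n - + 1))
      ≡⟨ solve (a ∷ d ∷ n ∷ []) ⟩
    (+ 1 + n) * (+ 6 * a * (a - + 1) + + 3 * d * (+ 2 * a - + 1) * ((+ 1 + n) - + 1)
                 + d * d * ((+ 1 + n) - + 1) * (+ 2 * (+ 1 + n) - + 1)) ∎

arith-sums : ∀ a d n {h γ} →
  + 2 * + a + + d * (+ n - + 1) ≡ h →
  + 6 * + a * (+ a - + 1) + + 3 * + d * (+ 2 * + a - + 1) * (+ n - + 1)
    + + d * + d * (+ n - + 1) * (+ 2 * + n - + 1) ≡ h * h - + 4 * h + γ →
  ExponentSums (arith a d n) (+ n) h γ
arith-sums a d n h≡ γ≡ = record
  { count       = cong +_ (length-arith a d n)
  ; sum         = trans (Σm-arith a d n) (cong (_*_ (+ n)) h≡)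
  ; sum-falling = trans (Σm[m-1]-arith a d n) (cong (_*_ (+ n)) γ≡)
  }

sums-A : ∀ n → ExponentSums (arith 1 1 n) (+ n) (+ 1 + + n) ((+ 1 + + n) * (+ 1 + + n))
sums-A n = arith-sums 1 1 n (h≡ (+ n)) (γ≡ (+ n))
  where
  h≡ : ∀ x → + 2 * + 1 + + 1 * (x - + 1) ≡ + 1 + x
  h≡ = solve-∀
  γ≡ : ∀ x → + 6 * + 1 * (+ 1 - + 1) + + 3 * + 1 * (+ 2 * + 1 - + 1) * (x - + 1)
               + + 1 * + 1 * (x - + 1) * (+ 2 * x - + 1)
             ≡ (+ 1 + x) * (+ 1 + x) - + 4 * (+ 1 + x) + (+ 1 + x) * (+ 1 + x)
  γ≡ = solve-∀

sums-B : ∀ n → ExponentSums (arith 1 2 n) (+ n) (+ 2 * + n) (+ 4 * + n * + n + + 2 * + n - + 2)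
sums-B n = arith-sums 1 2 n (h≡ (+ n)) (γ≡ (+ n))
  where
  h≡ : ∀ x → + 2 * + 1 + + 2 * (x - + 1) ≡ + 2 * x
  h≡ = solve-∀
  γ≡ : ∀ x → + 6 * + 1 * (+ 1 - + 1) + + 3 * + 2 * (+ 2 * + 1 - + 1) * (x - + 1)
               + + 2 * + 2 * (x - + 1) * (+ 2 * x - + 1)
             ≡ + 2 * x * (+ 2 * x) - + 4 * (+ 2 * x) + (+ 4 * x * x + + 2 * x - + 2)
  γ≡ = solve-∀

-- The exponents of D_{n+1} are those of B_n together with n.
sums-D : ∀ n → ExponentSums (arith 1 2 n ++ n ∷ []) (+ 1 + + n) (+ 2 * + n) (+ 2 * + n * (+ 2 * + n))
sums-D n = record
  { count       = cong +_ (trans (length-++ xs)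
                                 (trans (cong (ℕ._+ 1) (length-arith 1 2 n)) (ℕₚ.+-comm n 1)))
  ; sum         = trans (cong (_*_ (+ 2)) (sum-++ (λ m → + m))) (sum≡ (+ n) (Σm xs) B.sum)
  ; sum-falling = trans (cong (_*_ (+ 6)) (sum-++ (λ m → + m * (+ m - + 1))))
                        (falling≡ (+ n) (Σm[m-1] xs) B.sum-falling)
  }
  where
  xs = arith 1 2 n
  module B = ExponentSums (sums-B n)
  sum-++ : ∀ (f : ℕ → ℤ) → sumℤ (map f (xs ++ n ∷ [])) ≡ sumℤ (map f xs) + (f n + + 0)
  sum-++ f = trans (cong sumℤ (map-++ f xs (n ∷ []))) (sumℤ-++ (map f xs) (f n ∷ []))
  sum≡ : ∀ x s → + 2 * s ≡ x * (+ 2 * x) → + 2 * (s + (x + + 0)) ≡ (+ 1 + x) * (+ 2 * x)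
  sum≡ x s eq = begin
    + 2 * (s + (x + + 0))         ≡⟨ solve (x ∷ s ∷ []) ⟩
    + 2 * s + + 2 * x             ≡⟨ cong (_+ + 2 * x) eq ⟩
    x * (+ 2 * x) + + 2 * x       ≡⟨ solve (x ∷ []) ⟩
    (+ 1 + x) * (+ 2 * x)         ∎
  falling≡ : ∀ x s →
    + 6 * s ≡ x * (+ 2 * x * (+ 2 * x) - + 4 * (+ 2 * x) + (+ 4 * x * x + + 2 * x - + 2)) →
    + 6 * (s + (x * (x - + 1) + + 0))
      ≡ (+ 1 + x) * (+ 2 * x * (+ 2 * x) - + 4 * (+ 2 * x) + + 2 * x * (+ 2 * x))
  falling≡ x s eq = begin
    + 6 * (s + (x * (x - + 1) + + 0))
      ≡⟨ solve (x ∷ s ∷ []) ⟩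
    + 6 * s + + 6 * (x * (x - + 1))
      ≡⟨ cong (_+ + 6 * (x * (x - + 1))) eq ⟩
    x * (+ 2 * x * (+ 2 * x) - + 4 * (+ 2 * x) + (+ 4 * x * x + + 2 * x - + 2)) + + 6 * (x * (x - + 1))
      ≡⟨ solve (x ∷ []) ⟩
    (+ 1 + x) * (+ 2 * x * (+ 2 * x) - + 4 * (+ 2 * x) + + 2 * x * (+ 2 * x)) ∎

sums-I : ∀ n → ExponentSums (1 ∷ n ∷ []) (+ 2) (+ 1 + + n)
                 (+ 2 * (+ 1 + + n) * (+ 1 + + n) + + 6 - + 5 * (+ 1 + + n))
sums-I n = record { count = refl ; sum = sum≡ (+ n) ; sum-falling = falling≡ (+ n) }
  where
  sum≡ : ∀ x → + 2 * (+ 1 + (x + + 0)) ≡ + 2 * (+ 1 + x)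
  sum≡ = solve-∀
  falling≡ : ∀ x → + 6 * (+ 1 * (+ 1 - + 1) + (x * (x - + 1) + + 0))
    ≡ + 2 * ((+ 1 + x) * (+ 1 + x) - + 4 * (+ 1 + x)
             + (+ 2 * (+ 1 + x) * (+ 1 + x) + + 6 - + 5 * (+ 1 + x)))
  falling≡ = solve-∀

pos-∸ : ∀ {m n} → n ≤ m → + (m ℕ.∸ n) ≡ + m - + n
pos-∸ {m} {n} n≤m = sym (trans (ℤₚ.m-n≡m⊖n m n) (ℤₚ.⊖-≥ n≤m))

pos-c*m*m : ∀ c m → + (c ℕ.* m ℕ.* m) ≡ + c * + m * + m
pos-c*m*m c m = trans (ℤₚ.pos-* (c ℕ.* m) m) (cong (_* + m) (ℤₚ.pos-* c m))

gammaInv-B : ∀ k → + gammaInv (B k) ≡ + 4 * + rank (B k) * + rank (B k) + + 2 * + rank (B k) - + 2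
gammaInv-B k = begin
  + gammaInv (B k)                           ≡⟨ pos-∸ (s≤s (s≤s z≤n)) ⟩
  + (4 ℕ.* r ℕ.* r) + + (2 ℕ.* r) - + 2     ≡⟨ cong₂ (λ x y → x + y - + 2) (pos-c*m*m 4 r) (ℤₚ.pos-* 2 r) ⟩
  + 4 * + r * + r + + 2 * + r - + 2          ∎
  where r = rank (B k)

gammaInv-I : ∀ k → let h = + coxeterNumber (I k) in + gammaInv (I k) ≡ + 2 * h * h + + 6 - + 5 * h
gammaInv-I k = begin
  + gammaInv (I k)                           ≡⟨ pos-∸ 5m≤2mm+6 ⟩
  + (2 ℕ.* m ℕ.* m) + + 6 - + (5 ℕ.* m)     ≡⟨ cong₂ (λ x y → x + + 6 - y) (pos-c*m*m 2 m) (ℤₚ.pos-* 5 m) ⟩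
  + 2 * + m * + m + + 6 - + 5 * + m          ∎
  where
  m = coxeterNumber (I k)
  5m≤2mm+6 : 5 ℕ.* m ≤ 2 ℕ.* m ℕ.* m ℕ.+ 6
  5m≤2mm+6 = subst (5 ℕ.* m ≤_) (sym (2mm+6≡5m+9+k[7+2k] k)) (ℕₚ.m≤m+n (5 ℕ.* m) _)
    where
    2mm+6≡5m+9+k[7+2k] : ∀ k → 2 ℕ.* (3 ℕ.+ k) ℕ.* (3 ℕ.+ k) ℕ.+ 6
                        ≡ 5 ℕ.* (3 ℕ.+ k) ℕ.+ (9 ℕ.+ k ℕ.* (7 ℕ.+ 2 ℕ.* k))
    2mm+6≡5m+9+k[7+2k] = ℕ-Solver.solve-∀

coxeterNumber-D : ∀ k → + coxeterNumber (D k) ≡ + 2 * + (3 ℕ.+ k)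
coxeterNumber-D k = trans (cong (λ n → + (n ℕ.∸ 2)) (ℕₚ.*-suc 2 (3 ℕ.+ k))) (ℤₚ.pos-* 2 (3 ℕ.+ k))

exponent-sums : ∀ T → ExponentSums (exponents T) (+ rank T) (+ coxeterNumber T) (+ gammaInv T)
exponent-sums (A k) = subst (ExponentSums _ _ _) (sym (ℤₚ.pos-* (2 ℕ.+ k) (2 ℕ.+ k))) (sums-A (suc k))
exponent-sums (B k) =
  subst₂ (ExponentSums _ _) (sym (ℤₚ.pos-* 2 (2 ℕ.+ k))) (sym (gammaInv-B k)) (sums-B (2 ℕ.+ k))
exponent-sums (D k) = subst₂ (ExponentSums _ _) (sym h≡) (sym γ≡) (sums-D (3 ℕ.+ k))
  where
  h≡ = coxeterNumber-D k
  γ≡ : + gammaInv (D k) ≡ + 2 * + (3 ℕ.+ k) * (+ 2 * + (3 ℕ.+ k))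
  γ≡ = trans (ℤₚ.pos-* (coxeterNumber (D k)) (coxeterNumber (D k))) (cong₂ _*_ h≡ h≡)
exponent-sums E6 = record { count = refl ; sum = refl ; sum-falling = refl }
exponent-sums E7 = record { count = refl ; sum = refl ; sum-falling = refl }
exponent-sums E8 = record { count = refl ; sum = refl ; sum-falling = refl }
exponent-sums F4 = record { count = refl ; sum = refl ; sum-falling = refl }
exponent-sums G2 = record { count = refl ; sum = refl ; sum-falling = refl }
exponent-sums H3 = record { count = refl ; sum = refl ; sum-falling = refl }
exponent-sums H4 = record { count = refl ; sum = refl ; sum-falling = refl }
exponent-sums (I k) = subst (ExponentSums _ _ _) (sym (gammaInv-I k)) (sums-I (2 ℕ.+ k))

rank-nonzero : ∀ T → + rank T ≢ 0ℤ
rank-nonzero (A _) ()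
rank-nonzero (B _) ()
rank-nonzero (D _) ()
rank-nonzero E6 ()
rank-nonzero E7 ()
rank-nonzero E8 ()
rank-nonzero F4 ()
rank-nonzero G2 ()
rank-nonzero H3 ()
rank-nonzero H4 ()
rank-nonzero (I _) ()

-- The recurrence x(n+2) = s x(n+1) − p x(n)

∑< : ℕ → (ℕ → ℤ) → ℤ
∑< n f = sumℤ (applyUpTo f n)

∑<-cong : ∀ n {f g : ℕ → ℤ} → f ≗ g → ∑< n f ≡ ∑< n g
∑<-cong zero    f≗g = refl
∑<-cong (suc n) f≗g = cong₂ _+_ (f≗g 0) (∑<-cong n (f≗g ∘ suc))

∑<-*ˡ : ∀ c n f → ∑< n (λ j → c * f j) ≡ c * ∑< n f
∑<-*ˡ c zero    f = sym (ℤₚ.*-zeroʳ c)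
∑<-*ˡ c (suc n) f =
  trans (cong (_+_ (c * f 0)) (∑<-*ˡ c n (f ∘ suc))) (sym (ℤₚ.*-distribˡ-+ c (f 0) _))

∑<-- : ∀ n f g → ∑< n (λ j → f j - g j) ≡ ∑< n f - ∑< n g
∑<-- zero    f g = refl
∑<-- (suc n) f g =
  trans (cong (_+_ (f 0 - g 0)) (∑<-- n (f ∘ suc) (g ∘ suc))) (interchange (f 0) (g 0) _ _)
  where
  interchange : ∀ a b c d → a - b + (c - d) ≡ a + c - (b + d)
  interchange = solve-∀

∑<-snoc : ∀ n f → ∑< (suc n) f ≡ ∑< n f + f n
∑<-snoc zero    f = ℤₚ.+-comm (f 0) 0ℤ
∑<-snoc (suc n) f = trans (cong (_+_ (f 0)) (∑<-snoc n (f ∘ suc))) (sym (ℤₚ.+-assoc (f 0) _ _))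

∑<-vanishing-tail : ∀ {m N} f → m ≤′ N → (∀ j → m ≤ j → f j ≡ 0ℤ) → ∑< N f ≡ ∑< m f
∑<-vanishing-tail f ℕ.≤′-refl _ = refl
∑<-vanishing-tail {m} f (ℕ.≤′-step {N} m≤′N) f≡0 = begin
  ∑< (suc N) f  ≡⟨ ∑<-snoc N f ⟩
  ∑< N f + f N  ≡⟨ cong (_+_ (∑< N f)) (f≡0 N (ℕₚ.≤′⇒≤ m≤′N)) ⟩
  ∑< N f + 0ℤ   ≡⟨ ℤₚ.+-identityʳ (∑< N f) ⟩
  ∑< N f        ≡⟨ ∑<-vanishing-tail f m≤′N f≡0 ⟩
  ∑< m f        ∎

recurrence-unique : ∀ (s p : ℤ) (u v : ℕ → ℤ) → u 0 ≡ v 0 → u 1 ≡ v 1 →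
  (∀ n → u (2 ℕ.+ n) ≡ s * u (1 ℕ.+ n) - p * u n) →
  (∀ n → v (2 ℕ.+ n) ≡ s * v (1 ℕ.+ n) - p * v n) →
  ∀ n → u n ≡ v n
recurrence-unique s p u v u₀ u₁ u-rec v-rec n = proj₁ (consecutive n)
  where
  consecutive : ∀ n → u n ≡ v n × u (suc n) ≡ v (suc n)
  consecutive zero    = u₀ , u₁
  consecutive (suc n) = let eₙ , eₙ₊₁ = consecutive n in eₙ₊₁ , (begin
    u (2 ℕ.+ n)                  ≡⟨ u-rec n ⟩
    s * u (1 ℕ.+ n) - p * u n    ≡⟨ cong₂ (λ x y → s * x - p * y) eₙ₊₁ eₙ ⟩
    s * v (1 ℕ.+ n) - p * v n    ≡⟨ v-rec n ⟨
    v (2 ℕ.+ n)                  ∎)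

X-as-∑< : ∀ a b n → X a b n ≡ ∑< (suc n) (λ j → a ^ j * b ^ (n ℕ.∸ j))
X-as-∑< a b n = cong sumℤ (map-applyUpTo id (λ j → a ^ j * b ^ (n ℕ.∸ j)) (suc n))

X-suc : ∀ a b n → X a b (suc n) ≡ b ^ suc n + a * X a b n
X-suc a b n = begin
  X a b (suc n)
    ≡⟨ X-as-∑< a b (suc n) ⟩
  + 1 * b ^ suc n + ∑< (suc n) (λ j → a * a ^ j * b ^ (n ℕ.∸ j))
    ≡⟨ cong₂ _+_ (ℤₚ.*-identityˡ (b ^ suc n))
                 (∑<-cong (suc n) λ j → ℤₚ.*-assoc a (a ^ j) (b ^ (n ℕ.∸ j))) ⟩
  b ^ suc n + ∑< (suc n) (λ j → a * (a ^ j * b ^ (n ℕ.∸ j)))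
    ≡⟨ cong (_+_ (b ^ suc n)) (∑<-*ˡ a (suc n) (λ j → a ^ j * b ^ (n ℕ.∸ j))) ⟩
  b ^ suc n + a * ∑< (suc n) (λ j → a ^ j * b ^ (n ℕ.∸ j))
    ≡⟨ cong (λ z → b ^ suc n + a * z) (X-as-∑< a b n) ⟨
  b ^ suc n + a * X a b n ∎

X-rec : ∀ a b n → X a b (2 ℕ.+ n) ≡ (a + b) * X a b (1 ℕ.+ n) - a * b * X a b n
X-rec a b n = begin
  X a b (2 ℕ.+ n)                               ≡⟨ X-suc a b (suc n) ⟩
  b ^ (2 ℕ.+ n) + a * X a b (1 ℕ.+ n)           ≡⟨ cong (λ z → b ^ (2 ℕ.+ n) + a * z) (X-suc a b n) ⟩
  b * u + a * (u + a * X a b n)                 ≡⟨ regroup a b u (X a b n) ⟩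
  (a + b) * (u + a * X a b n) - a * b * X a b n ≡⟨ cong (λ z → (a + b) * z - a * b * X a b n) (X-suc a b n) ⟨
  (a + b) * X a b (1 ℕ.+ n) - a * b * X a b n   ∎
  where
  u = b ^ suc n
  regroup : ∀ a b u x → b * u + a * (u + a * x) ≡ (a + b) * (u + a * x) - a * b * x
  regroup = solve-∀

chebTerm : ℤ → ℤ → ℕ → ℕ → ℤ
chebTerm s p n j = (- + 1) ^ j * + ((n ℕ.∸ j) C j) * s ^ (n ℕ.∸ 2 ℕ.* j) * p ^ j

chebWeight : ℤ → ℕ → ℕ → ℤ
chebWeight s n j = + ((n ℕ.∸ j) C j) * s ^ (n ℕ.∸ 2 ℕ.* j)

chebTerm≡chebWeight : ∀ s p n j → chebTerm s p n j ≡ (- + 1) ^ j * chebWeight s n j * p ^ j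
chebTerm≡chebWeight s p n j = cong (_* p ^ j) (ℤₚ.*-assoc ((- + 1) ^ j) _ _)

chebWeight-vanishes : ∀ s n j → n ℕ.∸ j < j → chebWeight s n j ≡ 0ℤ
chebWeight-vanishes s n j n∸j<j = cong (λ c → + c * s ^ (n ℕ.∸ 2 ℕ.* j)) (k>n⇒nCk≡0 n∸j<j)

m≤n⇒m∸n<k : ∀ {m n k} → m ≤ n → 0 < k → m ℕ.∸ n < k
m≤n⇒m∸n<k {k = k} m≤n 0<k = subst (_< k) (sym (ℕₚ.m≤n⇒m∸n≡0 m≤n)) 0<k

chebWeight-shift : ∀ s n j →
  + ((n ℕ.∸ j) C suc j) * s ^ (n ℕ.∸ 2 ℕ.* j) ≡ s * chebWeight s (1 ℕ.+ n) (1 ℕ.+ j)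
chebWeight-shift s n j with suc (2 ℕ.* j) ℕₚ.≤? n
... | yes 2j<n = begin
  + c * s ^ (n ℕ.∸ 2 ℕ.* j)                  ≡⟨ cong (λ e → + c * s ^ e) (ℕₚ.+-∸-assoc 1 2j<n) ⟩
  + c * (s * s ^ (n ℕ.∸ suc (2 ℕ.* j)))     ≡⟨ commute (+ c) s (s ^ (n ℕ.∸ suc (2 ℕ.* j))) ⟩
  s * (+ c * s ^ (n ℕ.∸ suc (2 ℕ.* j)))     ≡⟨ cong (λ e → s * (+ c * s ^ (suc n ℕ.∸ e))) (ℕₚ.*-suc 2 j) ⟨
  s * chebWeight s (1 ℕ.+ n) (1 ℕ.+ j)      ∎
  where
  c = (n ℕ.∸ j) C suc j
  commute : ∀ c s x → c * (s * x) ≡ s * (c * x)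
  commute = solve-∀
... | no 2j≮n = begin
  + c * s ^ (n ℕ.∸ 2 ℕ.* j)                 ≡⟨ cong (λ k → + k * s ^ (n ℕ.∸ 2 ℕ.* j)) c≡0 ⟩
  0ℤ                                        ≡⟨ ℤₚ.*-zeroʳ s ⟨
  s * 0ℤ                                    ≡⟨ cong (λ k → s * (+ k * s ^ (suc n ℕ.∸ 2 ℕ.* suc j))) c≡0 ⟨
  s * chebWeight s (1 ℕ.+ n) (1 ℕ.+ j)      ∎
  where
  c = (n ℕ.∸ j) C suc j
  n≤j+j : n ≤ j ℕ.+ j
  n≤j+j = subst (n ≤_) (cong (j ℕ.+_) (ℕₚ.+-identityʳ j)) (ℕₚ.≤-pred (ℕₚ.≰⇒> 2j≮n))
  c≡0 : c ≡ 0
  c≡0 = k>n⇒nCk≡0 (s≤s (ℕₚ.m≤n+o⇒m∸n≤o n j n≤j+j))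

chebWeight-pascal : ∀ s n j →
  chebWeight s (2 ℕ.+ n) (1 ℕ.+ j) ≡ chebWeight s n j + s * chebWeight s (1 ℕ.+ n) (1 ℕ.+ j)
chebWeight-pascal s n j with j ℕₚ.≤? n
... | no j≰n = begin
  chebWeight s (2 ℕ.+ n) (1 ℕ.+ j)
    ≡⟨ chebWeight-vanishes s (2 ℕ.+ n) (1 ℕ.+ j) (m≤n⇒m∸n<k n<j (s≤s z≤n)) ⟩
  0ℤ                                                      ≡⟨ solve (s ∷ []) ⟩
  0ℤ + s * 0ℤ                                             ≡⟨ cong₂ (λ x y → x + s * y) w₀ w₁ ⟨
  chebWeight s n j + s * chebWeight s (1 ℕ.+ n) (1 ℕ.+ j) ∎
  where
  n<j = ℕₚ.≰⇒> j≰n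
  w₀ = chebWeight-vanishes s n j (m≤n⇒m∸n<k (ℕₚ.<⇒≤ n<j) (ℕₚ.≤-<-trans z≤n n<j))
  w₁ = chebWeight-vanishes s (1 ℕ.+ n) (1 ℕ.+ j) (m≤n⇒m∸n<k (ℕₚ.<⇒≤ n<j) (s≤s z≤n))
... | yes j≤n = begin
  chebWeight s (2 ℕ.+ n) (1 ℕ.+ j)
    ≡⟨ cong₂ (λ c e → + c * s ^ e) pascal (cong (2 ℕ.+ n ℕ.∸_) (ℕₚ.*-suc 2 j)) ⟩
  (+ (m C j) + + (m C suc j)) * s ^ (n ℕ.∸ 2 ℕ.* j)
    ≡⟨ ℤₚ.*-distribʳ-+ (s ^ (n ℕ.∸ 2 ℕ.* j)) (+ (m C j)) (+ (m C suc j)) ⟩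
  chebWeight s n j + + (m C suc j) * s ^ (n ℕ.∸ 2 ℕ.* j)
    ≡⟨ cong (_+_ (chebWeight s n j)) (chebWeight-shift s n j) ⟩
  chebWeight s n j + s * chebWeight s (1 ℕ.+ n) (1 ℕ.+ j) ∎
  where
  m = n ℕ.∸ j
  pascal : (suc n ℕ.∸ j) C suc j ≡ m C j ℕ.+ m C suc j
  pascal = trans (cong (_C suc j) (ℕₚ.+-∸-assoc 1 j≤n)) (sym (nCk+nC[k+1]≡[n+1]C[k+1] m j))

chebTerm-rec : ∀ s p n j →
  chebTerm s p (2 ℕ.+ n) (1 ℕ.+ j) ≡ s * chebTerm s p (1 ℕ.+ n) (1 ℕ.+ j) - p * chebTerm s p n j
chebTerm-rec s p n j = begin
  chebTerm s p (2 ℕ.+ n) (1 ℕ.+ j)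
    ≡⟨ chebTerm≡chebWeight s p (2 ℕ.+ n) (1 ℕ.+ j) ⟩
  (- + 1 * σ) * chebWeight s (2 ℕ.+ n) (1 ℕ.+ j) * (p * π)
    ≡⟨ cong (λ w → (- + 1 * σ) * w * (p * π)) (chebWeight-pascal s n j) ⟩
  (- + 1 * σ) * (w + s * w′) * (p * π)
    ≡⟨ regroup s p σ π w w′ ⟩
  s * ((- + 1 * σ) * w′ * (p * π)) - p * (σ * w * π)
    ≡⟨ cong₂ (λ x y → s * x - p * y) (chebTerm≡chebWeight s p (1 ℕ.+ n) (1 ℕ.+ j)) (chebTerm≡chebWeight s p n j) ⟨
  s * chebTerm s p (1 ℕ.+ n) (1 ℕ.+ j) - p * chebTerm s p n j ∎
  where
  σ = (- + 1) ^ j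
  π = p ^ j
  w = chebWeight s n j
  w′ = chebWeight s (1 ℕ.+ n) (1 ℕ.+ j)
  regroup : ∀ s p σ π w w′ →
    (- + 1 * σ) * (w + s * w′) * (p * π) ≡ s * ((- + 1 * σ) * w′ * (p * π)) - p * (σ * w * π)
  regroup = solve-∀

chebTerm-rec₀ : ∀ s p n → chebTerm s p (2 ℕ.+ n) 0 ≡ s * chebTerm s p (1 ℕ.+ n) 0
chebTerm-rec₀ s p n = regroup s (s ^ suc n)
  where
  regroup : ∀ s x → + 1 * + 1 * (s * x) * + 1 ≡ s * (+ 1 * + 1 * x * + 1)
  regroup = solve-∀

⌊n/2⌋<j⇒n∸j<j : ∀ {n j} → suc ⌊ n /2⌋ ≤ j → n ℕ.∸ j < j
⌊n/2⌋<j⇒n∸j<j {n} {suc j} ⌊n/2⌋<j@(s≤s _) = ℕₚ.m<n+o⇒m∸n<o n (suc j)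
  (subst (_< suc j ℕ.+ suc j) (ℕₚ.⌊n/2⌋+⌈n/2⌉≡n n)
    (ℕₚ.+-mono-<-≤ ⌊n/2⌋<j (ℕₚ.≤-trans (ℕₚ.⌊n/2⌋-mono (ℕₚ.n≤1+n (suc n))) ⌊n/2⌋<j)))

chebTerm-vanishes : ∀ s p n j → suc ⌊ n /2⌋ ≤ j → chebTerm s p n j ≡ 0ℤ
chebTerm-vanishes s p n j ⌊n/2⌋<j = begin
  chebTerm s p n j
    ≡⟨ chebTerm≡chebWeight s p n j ⟩
  (- + 1) ^ j * chebWeight s n j * p ^ j
    ≡⟨ cong (λ w → (- + 1) ^ j * w * p ^ j) (chebWeight-vanishes s n j (⌊n/2⌋<j⇒n∸j<j ⌊n/2⌋<j)) ⟩
  (- + 1) ^ j * 0ℤ * p ^ j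
    ≡⟨ cong (_* p ^ j) (ℤₚ.*-zeroʳ ((- + 1) ^ j)) ⟩
  0ℤ ∎

chebSum-as-∑< : ∀ s p n N → suc ⌊ n /2⌋ ≤ N → chebSum s p n ≡ ∑< N (chebTerm s p n)
chebSum-as-∑< s p n N ⌊n/2⌋<N = trans
  (cong sumℤ (map-applyUpTo id (chebTerm s p n) (suc ⌊ n /2⌋)))
  (sym (∑<-vanishing-tail (chebTerm s p n) (ℕₚ.≤⇒≤′ ⌊n/2⌋<N) (chebTerm-vanishes s p n)))

chebSum-rec : ∀ s p n → chebSum s p (2 ℕ.+ n) ≡ s * chebSum s p (1 ℕ.+ n) - p * chebSum s p n
chebSum-rec s p n = begin
  chebSum s p (2 ℕ.+ n)
    ≡⟨ chebSum-as-∑< s p (2 ℕ.+ n) (3 ℕ.+ n) (bound 0 (2 ℕ.+ n)) ⟩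
  T (2 ℕ.+ n) 0 + ∑< (2 ℕ.+ n) (λ j → T (2 ℕ.+ n) (suc j))
    ≡⟨ cong₂ _+_ (chebTerm-rec₀ s p n) (∑<-cong (2 ℕ.+ n) (chebTerm-rec s p n)) ⟩
  s * T (1 ℕ.+ n) 0 + ∑< (2 ℕ.+ n) (λ j → s * T (1 ℕ.+ n) (suc j) - p * T n j)
    ≡⟨ cong (_+_ (s * T (1 ℕ.+ n) 0))
         (trans (∑<-- (2 ℕ.+ n) (λ j → s * T (1 ℕ.+ n) (suc j)) (λ j → p * T n j))
                (cong₂ _-_ (∑<-*ˡ s (2 ℕ.+ n) (λ j → T (1 ℕ.+ n) (suc j))) (∑<-*ˡ p (2 ℕ.+ n) (T n)))) ⟩
  s * T (1 ℕ.+ n) 0 + (s * ∑< (2 ℕ.+ n) (λ j → T (1 ℕ.+ n) (suc j)) - p * ∑< (2 ℕ.+ n) (T n))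
    ≡⟨ regroup s p (T (1 ℕ.+ n) 0) _ _ ⟩
  s * ∑< (3 ℕ.+ n) (T (1 ℕ.+ n)) - p * ∑< (2 ℕ.+ n) (T n)
    ≡⟨ cong₂ (λ x y → s * x - p * y) (chebSum-as-∑< s p (1 ℕ.+ n) (3 ℕ.+ n) (bound 1 (1 ℕ.+ n)))
                                     (chebSum-as-∑< s p n (2 ℕ.+ n) (bound 1 n)) ⟨
  s * chebSum s p (1 ℕ.+ n) - p * chebSum s p n ∎
  where
  T = chebTerm s p
  bound : ∀ k n → suc ⌊ n /2⌋ ≤ k ℕ.+ suc n
  bound k n = ℕₚ.≤-trans (s≤s (ℕₚ.⌊n/2⌋≤n n)) (ℕₚ.m≤n+m (suc n) k)
  regroup : ∀ s p x y z → s * x + (s * y - p * z) ≡ s * (x + y) - p * z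
  regroup = solve-∀

X≡chebSum : ∀ a b n → X a b n ≡ chebSum (a + b) (a * b) n
X≡chebSum a b = recurrence-unique (a + b) (a * b) (X a b) (chebSum (a + b) (a * b))
  refl (base a b) (X-rec a b) (chebSum-rec (a + b) (a * b))
  where
  base : ∀ a b → + 1 * (b * + 1) + (a * + 1 * + 1 + + 0) ≡ + 1 * + 1 * ((a + b) * + 1) * + 1 + + 0
  base = solve-∀

lemma5p2 : (T : CoxeterType) (A B α β : ℕ) →
    1 ≤ A → 1 ≤ B → 1 ≤ α → 1 ≤ β →
    (∀ (q : ℤ) → expPoly T q * ((+ 1 - q ^ α) * (+ 1 - q ^ β))
                 ≡ q * (+ 1 - q ^ A) * (+ 1 - q ^ B)) →
    (+ A + + B ≡ + coxeterNumber T - + 2 + + α + + β)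
    × (+ A * + B ≡ + coxeterNumber T * + coxeterNumber T - + gammaInv T
                   + (+ coxeterNumber T - + 2) * (+ α + + β - + 1) + + α * + β)
    × (∀ (n : ℕ) → X (+ A) (+ B) n
         ≡ chebSum (+ coxeterNumber T - + 2 + + α + + β)
                   (+ coxeterNumber T * + coxeterNumber T - + gammaInv T
                     + (+ coxeterNumber T - + 2) * (+ α + + β - + 1) + + α * + β) n)
lemma5p2 T a b α β _ _ 1≤α 1≤β H =
  let sum≡ , product≡ = sum-and-product (expPoly T) α β a b (rank-nonzero T) 1≤α 1≤β
                          (exponent-polynomial-jet (exponent-sums T)) H
  in sum≡ , product≡ , λ n → trans (X≡chebSum (+ a) (+ b) n) (cong₂ (λ s p → chebSum s p n) sum≡ product≡)
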